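{- Let $D$ be the shadow, on the $2$-sphere $S^2$, of the standard $5$-crossing diagram of the twist knot $5_2$ (a two-crossing clasp together with a row of three half-twists). Then for every connected smoothed state of $D$ taken as the starting game board, if Player C moves first in the Region Smoothing Swap Game, Player C has a winning strategy.
   Context: A link shadow is a link diagram on a closed surface $S$ with over/under information omitted at its crossings (called precrossings); it is assumed connected, and the components of the complement of the shadow in $S$ are called regions. Each precrossing can be smoothed in one of two ways (replacing the crossing by two non-crossing arcs). A choice of smoothing at every precrossing is a smoothed state; it is a collection of disjoint simple closed curves on $S$, and is called connected if it consists of exactly one closed curve. A region smoothing swap at a region $r$ replaces the smoothing at every precrossing on the boundary of $r$ by the other smoothing. The Region Smoothing Swap Game: start from a connected smoothed state (the game board). Two players, C and D, alternate turns; on a turn the player selects a region not selected before and either performs the region smoothing swap at it or leaves the state unchanged. The game ends when every region has been selected exactly once. Player C wins if the final smoothed state is connected; otherwise Player D wins. -}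

module Defs where

open import Data.Bool using (Bool; true; false; not; if_then_else_)
open import Data.Nat using (ℕ; zero; suc)
open import Data.Fin using (Fin; zero; suc)
open import Data.Fin.Patterns
open import Data.Fin.Subset using (Subset; _∈_; ⊤; _-_)
open import Data.Vec using (Vec; lookup; tabulate)
open import Data.Product using (_×_; _,_; Σ-syntax; ∃-syntax)
open import Data.Sum using (_⊎_)
open import Function using (_∘_)
open import Relation.Binary.PropositionalEquality using (_≡_)

-- The shadow D of the standard 5-crossing diagram of the twist knot 5_2
-- on S², as a combinatorial 4-regular plane map.
--
-- It is the shadow of the PD code
--   X[1,4,2,5], X[3,8,4,9], X[5,10,6,1], X[9,6,10,7], X[7,2,8,3]
-- (crossings 0..4 in this order; the four slots 0..3 of each crossing
-- are listed counterclockwise).  Edges (arcs of the shadow between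
-- precrossings) are labelled 1..10.
--
-- Faces (computed from the rotation system; 5 - 10 + 7 = 2, so S²):
--   region 0 : crossings {0,1,2,3}   (square)
--   region 1 : crossings {0,1,4}     (triangle)
--   region 2 : crossings {0,2,3,4}   (square)
--   region 3 : crossings {0,2}       (bigon, twist row)
--   region 4 : crossings {1,4}       (bigon, the clasp)
--   region 5 : crossings {1,3,4}     (triangle)
--   region 6 : crossings {2,3}       (bigon, twist row)
-- The twist row of three half-twists is crossings 0,2,3 (bigons 3, 6),
-- the two-crossing clasp is crossings 1,4 (bigon 4).

Crossing : Set
Crossing = Fin 5

Region : Set
Region = Fin 7

numRegions : ℕ
numRegions = 7

HalfEdge : Set
HalfEdge = Crossing × Fin 4

pd : Crossing → Fin 4 → ℕ
pd 0F = lookup (Data.Vec.fromList (1 Data.List.∷ 4 Data.List.∷ 2 Data.List.∷ 5 Data.List.∷ Data.List.[]))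
  where import Data.List
pd 1F = lookup (Data.Vec.fromList (3 Data.List.∷ 8 Data.List.∷ 4 Data.List.∷ 9 Data.List.∷ Data.List.[]))
  where import Data.List
pd 2F = lookup (Data.Vec.fromList (5 Data.List.∷ 10 Data.List.∷ 6 Data.List.∷ 1 Data.List.∷ Data.List.[]))
  where import Data.List
pd 3F = lookup (Data.Vec.fromList (9 Data.List.∷ 6 Data.List.∷ 10 Data.List.∷ 7 Data.List.∷ Data.List.[]))
  where import Data.List
pd 4F = lookup (Data.Vec.fromList (7 Data.List.∷ 2 Data.List.∷ 8 Data.List.∷ 3 Data.List.∷ Data.List.[]))
  where import Data.List

-- The other end of the edge leaving a half-edge (the unique other slot
-- carrying the same label in pd).
arc : HalfEdge → HalfEdge
arc (0F , 0F) = (2F , 3F)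
arc (0F , 1F) = (1F , 2F)
arc (0F , 2F) = (4F , 1F)
arc (0F , 3F) = (2F , 0F)
arc (1F , 0F) = (4F , 3F)
arc (1F , 1F) = (4F , 2F)
arc (1F , 2F) = (0F , 1F)
arc (1F , 3F) = (3F , 0F)
arc (2F , 0F) = (0F , 3F)
arc (2F , 1F) = (3F , 2F)
arc (2F , 2F) = (3F , 1F)
arc (2F , 3F) = (0F , 0F)
arc (3F , 0F) = (1F , 3F)
arc (3F , 1F) = (2F , 2F)
arc (3F , 2F) = (2F , 1F)
arc (3F , 3F) = (4F , 0F)
arc (4F , 0F) = (3F , 3F)
arc (4F , 1F) = (0F , 2F)
arc (4F , 2F) = (1F , 1F)
arc (4F , 3F) = (1F , 0F)

onBoundary : Region → Crossing → Bool
onBoundary 0F c = lookup (true  Data.Vec.∷ true  Data.Vec.∷ true  Data.Vec.∷ true  Data.Vec.∷ false Data.Vec.∷ Data.Vec.[]) c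
onBoundary 1F c = lookup (true  Data.Vec.∷ true  Data.Vec.∷ false Data.Vec.∷ false Data.Vec.∷ true  Data.Vec.∷ Data.Vec.[]) c
onBoundary 2F c = lookup (true  Data.Vec.∷ false Data.Vec.∷ true  Data.Vec.∷ true  Data.Vec.∷ true  Data.Vec.∷ Data.Vec.[]) c
onBoundary 3F c = lookup (true  Data.Vec.∷ false Data.Vec.∷ true  Data.Vec.∷ false Data.Vec.∷ false Data.Vec.∷ Data.Vec.[]) c
onBoundary 4F c = lookup (false Data.Vec.∷ true  Data.Vec.∷ false Data.Vec.∷ false Data.Vec.∷ true  Data.Vec.∷ Data.Vec.[]) c
onBoundary 5F c = lookup (false Data.Vec.∷ true  Data.Vec.∷ false Data.Vec.∷ true  Data.Vec.∷ true  Data.Vec.∷ Data.Vec.[]) c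
onBoundary 6F c = lookup (false Data.Vec.∷ false Data.Vec.∷ true  Data.Vec.∷ true  Data.Vec.∷ false Data.Vec.∷ Data.Vec.[]) c

-- Smoothed states.  At each precrossing there are two smoothings:
--   false : slots 0–1 and 2–3 are joined,
--   true  : slots 1–2 and 3–0 are joined.

SmoothedState : Set
SmoothedState = Vec Bool 5

smoothPartner : Bool → Fin 4 → Fin 4
smoothPartner false 0F = 1F
smoothPartner false 1F = 0F
smoothPartner false 2F = 3F
smoothPartner false 3F = 2F
smoothPartner true  0F = 3F
smoothPartner true  1F = 2F
smoothPartner true  2F = 1F
smoothPartner true  3F = 0F

smooth : SmoothedState → HalfEdge → HalfEdge
smooth s (c , j) = (c , smoothPartner (lookup s c) j)

-- Travel along an edge, then through the smoothing at its far end.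
-- Iterating this traces the closed curve of the smoothed state.
step : SmoothedState → HalfEdge → HalfEdge
step s = smooth s ∘ arc

iter : {A : Set} → (A → A) → ℕ → A → A
iter f zero    a = a
iter f (suc n) a = f (iter f n a)

base : HalfEdge
base = (0F , 0F)

-- The smoothed state is connected: the closed curve through the base
-- half-edge passes through every half-edge (so the state is one curve).
-- The half-edges on that curve are exactly  step^k base  and
-- arc (step^k base).
Connected : SmoothedState → Set
Connected s = (h : HalfEdge) →
  ∃[ k ] (iter (step s) k base ≡ h ⊎ arc (iter (step s) k base) ≡ h)

swap : Region → SmoothedState → SmoothedState
swap r s = tabulate (λ c → if onBoundary r c then not (lookup s c) else lookup s c)

applyMove : Region → Bool → SmoothedState → SmoothedState
applyMove r true  s = swap r s
applyMove r false s = s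

-- CHasWinningStrategyC k s av : it is C's turn, k
-- turns remain, the current state is s, av is the set of regions not
-- selected yet; C can force that the final state is connected.
-- CHasWinningStrategyD k s av : same, but it is D's turn (C still forces the win).

mutual
  CHasWinningStrategyC : ℕ → SmoothedState → Subset 7 → Set
  CHasWinningStrategyC zero    s av = Connected s
  CHasWinningStrategyC (suc k) s av =
    Σ[ r ∈ Region ] (r ∈ av × Σ[ b ∈ Bool ] CHasWinningStrategyD k (applyMove r b s) (av - r))

  CHasWinningStrategyD : ℕ → SmoothedState → Subset 7 → Set
  CHasWinningStrategyD zero    s av = Connected s
  CHasWinningStrategyD (suc k) s av =
    (r : Region) → r ∈ av → (b : Bool) → CHasWinningStrategyC k (applyMove r b s) (av - r)

-- Since a region smoothing swap only toggles the smoothings around one region, the game is a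
-- finite game on the 32 smoothed states of D: seven turns, C moving first and last.  Seven of
-- these states are connected, and evaluating the game tree shows that C can force the final
-- state into those seven from every starting state.

module Submission where

open import Defs
open import Data.Bool using (Bool; true; false; T; not; _∧_; _∨_; T?)
open import Data.Bool.ListAction using (any; all)
import Data.Bool.Properties as Bool
open import Data.Fin.Properties using (all?)
import Data.Fin.Properties as Fin
open import Data.Fin.Subset using (Subset; _-_; ⊤)
open import Data.Fin.Subset.Properties using (_∈?_)
open import Data.List using (List; []; _∷_; upTo; allFin)
open import Data.List.Membership.Propositional using (_∈_)
open import Data.List.Membership.Propositional.Properties using (∈-allFin)
open import Data.List.Relation.Unary.All as All using (All)
open import Data.List.Relation.Unary.All.Properties using (all⁺)
open import Data.List.Relation.Unary.Any as Any using (Any; here; there)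
open import Data.List.Relation.Unary.Any.Properties using (any⁻)
open import Data.Nat using (ℕ; zero; suc)
open import Data.Product using (_,_)
import Data.Product.Properties as Product
open import Data.Sum using (_⊎_)
open import Data.Vec using (_∷_; [])
import Data.Vec.Properties as Vec
open import Function using (Equivalence)
open import Relation.Binary.Definitions using (DecidableEquality)
open import Relation.Binary.PropositionalEquality using (_≡_; refl)
open import Relation.Nullary using (Dec; _because_; map′; does; isYes; _×-dec_; _⊎-dec_; toWitness; fromWitness)
open import Relation.Nullary.Reflects using (invert)
open import Relation.Unary using (Decidable)

dec-true⁻ : ∀ {A : Set} (a? : Dec A) → does a? ≡ true → A
dec-true⁻ (true because [a]) refl = invert [a]

allSubset? : ∀ {n} {P : Subset n → Set} → Decidable P → Dec ((p : Subset n) → P p)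
allSubset? {zero}  P? = map′ (λ { p [] → p }) (λ f → f []) (P? [])
allSubset? {suc n} P? = map′ (λ { (f , g) (false ∷ p) → f p ; (f , g) (true ∷ p) → g p })
  (λ f → (λ p → f (false ∷ p)) , (λ p → f (true ∷ p)))
  (allSubset? (λ p → P? (false ∷ p)) ×-dec allSubset? (λ p → P? (true ∷ p)))

T-implication : ∀ {x y} → T (not x ∨ y) → T x → T y
T-implication {true} y _ = y

bools : List Bool
bools = false ∷ true ∷ []

∈-bools : ∀ b → b ∈ bools
∈-bools false = here refl
∈-bools true  = there (here refl)

TracedAt : SmoothedState → HalfEdge → ℕ → Set
TracedAt s h k = iter (step s) k base ≡ h ⊎ arc (iter (step s) k base) ≡ h

tracedAt? : ∀ s h → Decidable (TracedAt s h)
tracedAt? s h k = iter (step s) k base ≟ h ⊎-dec arc (iter (step s) k base) ≟ h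
  where
  _≟_ : DecidableEquality HalfEdge
  _≟_ = Product.≡-dec Fin._≟_ Fin._≟_

ConnectedWithin : ℕ → SmoothedState → Set
ConnectedWithin n s = ∀ c j → Any (TracedAt s (c , j)) (upTo n)

connectedWithin? : ∀ n → Decidable (ConnectedWithin n)
connectedWithin? n s = all? λ c → all? λ j → Any.any? (tracedAt? s (c , j)) (upTo n)

connectedWithin⇒connected : ∀ {n s} → ConnectedWithin n s → Connected s
connectedWithin⇒connected traced (c , j) = Any.satisfied (traced c j)

connectedStates : List SmoothedState
connectedStates =
  (false ∷ false ∷ false ∷ true  ∷ true  ∷ []) ∷
  (false ∷ false ∷ true  ∷ false ∷ true  ∷ []) ∷
  (false ∷ true  ∷ false ∷ false ∷ true  ∷ []) ∷
  (false ∷ true  ∷ false ∷ true  ∷ false ∷ []) ∷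
  (false ∷ true  ∷ true  ∷ false ∷ false ∷ []) ∷
  (true  ∷ false ∷ false ∷ false ∷ true  ∷ []) ∷
  (true  ∷ true  ∷ false ∷ false ∷ false ∷ []) ∷ []

-- The curve of a connected state runs once through all 10 edges of D, so 10 steps suffice.
connectedStates-connected : All Connected connectedStates
connectedStates-connected = All.map (λ {s} → connectedWithin⇒connected {s = s})
  (dec-true⁻ (All.all? (connectedWithin? 10) connectedStates) refl)

∈-connectedStates? : Decidable (_∈ connectedStates)
∈-connectedStates? s = Any.any? (Vec.≡-dec Bool._≟_ s) connectedStates

module Game {Goal : SmoothedState → Set} (goal? : Decidable Goal) where

  mutual
    cWins : ℕ → SmoothedState → Subset 7 → Bool
    cWins zero    s av = isYes (goal? s)
    cWins (suc k) s av = any (cWinsPlaying k s av) (allFin 7)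

    dWins : ℕ → SmoothedState → Subset 7 → Bool
    dWins zero    s av = isYes (goal? s)
    dWins (suc k) s av = all (cWinsAgainst k s av) (allFin 7)

    cWinsPlaying : ℕ → SmoothedState → Subset 7 → Region → Bool
    cWinsPlaying k s av r = isYes (r ∈? av) ∧ any (λ b → dWins k (applyMove r b s) (av - r)) bools

    cWinsAgainst : ℕ → SmoothedState → Subset 7 → Region → Bool
    cWinsAgainst k s av r = not (isYes (r ∈? av)) ∨ all (λ b → cWins k (applyMove r b s) (av - r)) bools

  -- s and av are explicit: inferring them from  T (cWins k s av)  would make Agda unfold
  -- the whole game tree.
  module _ (goal⇒connected : ∀ {s} → Goal s → Connected s) where
    mutual
      cWins-sound : ∀ k s av → T (cWins k s av) → CHasWinningStrategyC k s av
      cWins-sound zero    s av win = goal⇒connected (toWitness {a? = goal? s} win)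
      cWins-sound (suc k) s av win with Any.satisfied (any⁻ (cWinsPlaying k s av) (allFin 7) win)
      ... | r , winPlaying with Equivalence.to Bool.T-∧ winPlaying
      ... | r∈av , winMove with Any.satisfied (any⁻ (λ b → dWins k (applyMove r b s) (av - r)) bools winMove)
      ... | b , winD = r , toWitness {a? = r ∈? av} r∈av , b , dWins-sound k (applyMove r b s) (av - r) winD

      dWins-sound : ∀ k s av → T (dWins k s av) → CHasWinningStrategyD k s av
      dWins-sound zero    s av win = goal⇒connected (toWitness {a? = goal? s} win)
      dWins-sound (suc k) s av win r r∈av b =
        cWins-sound k (applyMove r b s) (av - r) (All.lookup winEitherMove (∈-bools b))
        where
        winAgainst : T (cWinsAgainst k s av r)
        winAgainst = All.lookup (all⁺ (cWinsAgainst k s av) (allFin 7) win) (∈-allFin r)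

        winEitherMove : All (λ b → T (cWins k (applyMove r b s) (av - r))) bools
        winEitherMove = all⁺ (λ b → cWins k (applyMove r b s) (av - r)) bools
          (T-implication winAgainst (fromWitness {a? = r ∈? av} r∈av))

open Game ∈-connectedStates?

everyStateWins : (s : SmoothedState) → T (cWins numRegions s ⊤)
everyStateWins = dec-true⁻ (allSubset? λ s → T? (cWins numRegions s ⊤)) refl

mainTheorem1 : (s : SmoothedState) → Connected s → CHasWinningStrategyC numRegions s ⊤
mainTheorem1 s _ = cWins-sound (All.lookup connectedStates-connected) numRegions s ⊤ (everyStateWins s)
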